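{- Let $f\colon\{0,1\}^n\to\{0,1,\perp\}$ be a partial function and $F(x,y)=f(x\oplus y)$. If $f$ is undefined on fewer than $2^{n-3}$ inputs and $\mathrm{D_{cc}^{\rightarrow}}(F)=2$, then $\mathrm{NADT^{\oplus}}(f)=2$.
   Context: $f$ is undefined at $x$ if $f(x)=\perp$; $\operatorname{Dom}(f)=f^{ -1}(\{0,1\})$, $\oplus$ is bitwise XOR, $\operatorname{Dom}(F)=\{(x,y):x\oplus y\in\operatorname{Dom}(f)\}$. $\mathrm{D_{cc}^{\rightarrow}}(F)$ is the minimum $t$ such that there are total $h\colon\{0,1\}^n\to\{0,1\}^t$ and $\varphi\colon\{0,1\}^t\times\{0,1\}^n\to\{0,1\}$ with $\varphi(h(x),y)=F(x,y)$ for all $(x,y)\in\operatorname{Dom}(F)$. With $\langle s,x\rangle=\bigoplus_is_i\wedge x_i$, $\mathrm{NADT^{\oplus}}(f)$ is the minimum $p$ such that there are $s_1,\dots,s_p\in\{0,1\}^n$ and total $l\colon\{0,1\}^p\to\{0,1\}$ with $l(\langle s_1,x\rangle,\dots,\langle s_p,x\rangle)=f(x)$ for all $x\in\operatorname{Dom}(f)$. -}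

module Defs where

open import Data.Nat using (ℕ; zero; suc; _≤_)
open import Data.Bool using (Bool; true; false; _xor_; _∧_)
open import Data.Maybe using (Maybe; just; nothing; is-nothing)
open import Data.Vec using (Vec; []; _∷_; zipWith; map; foldr)
open import Data.List using (List; []; _∷_; _++_; length; filter; filterᵇ)
import Data.List as L
open import Data.Product using (Σ; _×_; ∃)
open import Relation.Binary.PropositionalEquality using (_≡_)

-- A partial Boolean function on {0,1}^n: nothing = ⊥ (undefined)
PartialFn : ℕ → Set
PartialFn n = Vec Bool n → Maybe Bool

-- x ∈ Dom(f)  iff  f x ≠ ⊥ ; we phrase "f x ≡ just b" directly where needed
-- bitwise XOR
_⊕_ : ∀ {n} → Vec Bool n → Vec Bool n → Vec Bool n
_⊕_ = zipWith _xor_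

allVecs : (n : ℕ) → List (Vec Bool n)
allVecs zero = [] ∷ []
allVecs (suc n) = L.map (false ∷_) (allVecs n) ++ L.map (true ∷_) (allVecs n)

undefCount : ∀ {n} → PartialFn n → ℕ
undefCount {n} f = length (filterᵇ (λ x → is-nothing (f x)) (allVecs n))

OneWayProtocol : ∀ {n} → PartialFn n → ℕ → Set
OneWayProtocol {n} f t =
  Σ (Vec Bool n → Vec Bool t) λ h →
  Σ (Vec Bool t → Vec Bool n → Bool) λ φ →
  ∀ (x y : Vec Bool n) (b : Bool) → f (x ⊕ y) ≡ just b → φ (h x) y ≡ b

⟨_,_⟩ : ∀ {n} → Vec Bool n → Vec Bool n → Bool
⟨ s , x ⟩ = foldr _ _xor_ false (zipWith _∧_ s x)

NADTp : ∀ {n} → PartialFn n → ℕ → Set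
NADTp {n} f p =
  Σ (Vec (Vec Bool n) p) λ ss →
  Σ (Vec Bool p → Bool) λ l →
  ∀ (x : Vec Bool n) (b : Bool) → f x ≡ just b → l (map (⟨_, x ⟩) ss) ≡ b

IsMin : (ℕ → Set) → ℕ → Set
IsMin P k = P k × (∀ t → P t → k ≤ t)

DccOneWay≡ : ∀ {n} → PartialFn n → ℕ → Set
DccOneWay≡ f k = IsMin (OneWayProtocol f) k

NADT⊕≡ : ∀ {n} → PartialFn n → ℕ → Set
NADT⊕≡ f k = IsMin (NADTp f) k

-- A parity tree yields a protocol: Alice sends her parities and Bob xors in his own.  Conversely,
-- take a 2-bit protocol (h, φ) and a message c sent by more than 2U inputs, U the number of
-- undefined points (one exists because 8U < 2^n).  If h x ≡ h x', then x ⊕ x' is a period of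
-- φ c: for every v some u with h u ≡ c has f defined at u ⊕ v and at u ⊕ v ⊕ x ⊕ x', and Bob's
-- answers to x and to x' on input x' ⊕ u ⊕ v must agree.  The periods form a subspace containing
-- every collision of the 2-bit map h, so it has codimension at most 2 and contains the common
-- kernel of two parities; on the domain, f x = φ c (u₀ ⊕ x) is then a function of them.
module Submission where

open import Defs
open import Data.Nat using (ℕ; _<_; _^_; _∸_; zero; suc; _+_; _*_; _≤_; z≤n; s≤s)
import Data.Nat.Properties as ℕ
open import Data.Nat.Tactic.RingSolver using (solve-∀)
open import Data.Bool using (Bool; true; false; _xor_; _∧_; _∨_; not; if_then_else_; T?)
import Data.Bool as Bool
open import Data.Bool.Properties
  using (xor-assoc; xor-comm; xor-same; ∧-assoc; ∧-distribˡ-xor; ∧-zeroʳ; ∧-identityʳ; ¬-not;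
         xor-∧-commutativeRing)
open import Data.Maybe using (Maybe; just; is-nothing)
open import Data.Vec using (Vec; []; _∷_; zipWith; map; replicate; head; tail)
import Data.Vec.Properties as Vecₚ
open import Data.Vec.Relation.Unary.All using (All; []; _∷_)
import Data.Vec.Relation.Unary.All as All
open import Data.Vec.Relation.Unary.All.Properties using (map⁻)
open import Data.List using (List; length; filterᵇ; _++_)
import Data.List as List
import Data.List.Properties as Listₚ
open import Data.Product using (∃; ∃₂; _×_; _,_; proj₁; proj₂)
open import Data.Sum using (_⊎_; inj₁; inj₂)
open import Data.Empty using (⊥-elim)
open import Function using (_∘_; case_of_)
open import Relation.Nullary using (Dec; yes; no; does; ¬?)
open import Relation.Nullary.Decidable using (map′; _⊎-dec_; _×-dec_; decidable-stable)
open import Relation.Binary.PropositionalEquality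
open import Algebra.Bundles using (CommutativeRing)
open import Algebra.Properties.CommutativeSemigroup
  (CommutativeRing.+-commutativeSemigroup xor-∧-commutativeRing)
  using () renaming (interchange to xor-interchange)
open import Algebra.Properties.CommutativeSemigroup ℕ.+-commutativeSemigroup
  using () renaming (interchange to +-interchange)

0ᵥ : ∀ n → Vec Bool n
0ᵥ n = replicate n false

⊕-assoc : ∀ {n} (x y z : Vec Bool n) → (x ⊕ y) ⊕ z ≡ x ⊕ (y ⊕ z)
⊕-assoc = Vecₚ.zipWith-assoc xor-assoc

⊕-comm : ∀ {n} (x y : Vec Bool n) → x ⊕ y ≡ y ⊕ x
⊕-comm = Vecₚ.zipWith-comm xor-comm

⊕-cancelˡ : ∀ {n} (x y : Vec Bool n) → x ⊕ (x ⊕ y) ≡ y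
⊕-cancelˡ []      []      = refl
⊕-cancelˡ (a ∷ x) (b ∷ y) =
  cong₂ _∷_ (trans (sym (xor-assoc a a b)) (cong (_xor b) (xor-same a))) (⊕-cancelˡ x y)

⟨⟩-linearʳ : ∀ {n} (s x y : Vec Bool n) → ⟨ s , x ⊕ y ⟩ ≡ ⟨ s , x ⟩ xor ⟨ s , y ⟩
⟨⟩-linearʳ []      []      []      = refl
⟨⟩-linearʳ (a ∷ s) (b ∷ x) (c ∷ y) = begin
  (a ∧ (b xor c)) xor ⟨ s , x ⊕ y ⟩
    ≡⟨ cong₂ _xor_ (∧-distribˡ-xor a b c) (⟨⟩-linearʳ s x y) ⟩
  ((a ∧ b) xor (a ∧ c)) xor (⟨ s , x ⟩ xor ⟨ s , y ⟩)
    ≡⟨ xor-interchange (a ∧ b) (a ∧ c) ⟨ s , x ⟩ ⟨ s , y ⟩ ⟩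
  ((a ∧ b) xor ⟨ s , x ⟩) xor ((a ∧ c) xor ⟨ s , y ⟩) ∎
  where open ≡-Reasoning

⟨⟩-zeroˡ : ∀ {n} (z : Vec Bool n) → ⟨ 0ᵥ n , z ⟩ ≡ false
⟨⟩-zeroˡ []      = refl
⟨⟩-zeroˡ (_ ∷ z) = ⟨⟩-zeroˡ z

parities-⊕ : ∀ {n k} (ss : Vec (Vec Bool n) k) (x y : Vec Bool n) →
             map ⟨_, x ⊕ y ⟩ ss ≡ zipWith _xor_ (map ⟨_, x ⟩ ss) (map ⟨_, y ⟩ ss)
parities-⊕ []       x y = refl
parities-⊕ (s ∷ ss) x y = cong₂ _∷_ (⟨⟩-linearʳ s x y) (parities-⊕ ss x y)

_≟ᵥ_ : ∀ {k} (a b : Vec Bool k) → Dec (a ≡ b)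
_≟ᵥ_ = Vecₚ.≡-dec Bool._≟_

does-true : ∀ {A : Set} (a? : Dec A) → does a? ≡ true → A
does-true (yes a) _ = a

∃? : ∀ n {P : Vec Bool n → Set} → (∀ x → Dec (P x)) → Dec (∃ P)
∃? zero    P? = map′ ([] ,_) (λ { ([] , p) → p }) (P? [])
∃? (suc n) {P} P? = map′ to from (∃? n (P? ∘ (false ∷_)) ⊎-dec ∃? n (P? ∘ (true ∷_)))
  where
  to : ∃ (P ∘ (false ∷_)) ⊎ ∃ (P ∘ (true ∷_)) → ∃ P
  to (inj₁ (x , p)) = false ∷ x , p
  to (inj₂ (x , p)) = true ∷ x , p
  from : ∃ P → ∃ (P ∘ (false ∷_)) ⊎ ∃ (P ∘ (true ∷_))
  from (false ∷ x , p) = inj₁ (x , p)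
  from (true ∷ x , p)  = inj₂ (x , p)

count : ∀ n → (Vec Bool n → Bool) → ℕ
count zero    p = if p [] then 1 else 0
count (suc n) p = count n (p ∘ (false ∷_)) + count n (p ∘ (true ∷_))

length-filterᵇ-map : ∀ {A B : Set} (p : B → Bool) (g : A → B) xs →
                     length (filterᵇ p (List.map g xs)) ≡ length (filterᵇ (p ∘ g) xs)
length-filterᵇ-map p g List.[] = refl
length-filterᵇ-map p g (x List.∷ xs) with p (g x)
... | true  = cong suc (length-filterᵇ-map p g xs)
... | false = length-filterᵇ-map p g xs

count-allVecs : ∀ n (p : Vec Bool n → Bool) → length (filterᵇ p (allVecs n)) ≡ count n p
count-allVecs zero p with p []
... | true  = refl
... | false = refl
count-allVecs (suc n) p = begin
  length (filterᵇ p (xs₀ ++ xs₁))             ≡⟨ cong length (Listₚ.filter-++ (T? ∘ p) xs₀ xs₁) ⟩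
  length (filterᵇ p xs₀ ++ filterᵇ p xs₁)     ≡⟨ Listₚ.length-++ (filterᵇ p xs₀) ⟩
  length (filterᵇ p xs₀) + length (filterᵇ p xs₁)
    ≡⟨ cong₂ _+_ (half false) (half true) ⟩
  count (suc n) p                             ∎
  where
  open ≡-Reasoning
  xs₀ xs₁ : List (Vec Bool (suc n))
  xs₀ = List.map (false ∷_) (allVecs n)
  xs₁ = List.map (true ∷_) (allVecs n)
  half : ∀ b → length (filterᵇ p (List.map (b ∷_) (allVecs n))) ≡ count n (p ∘ (b ∷_))
  half b = trans (length-filterᵇ-map p (b ∷_) (allVecs n)) (count-allVecs n (p ∘ (b ∷_)))

count-cong : ∀ n {p q : Vec Bool n → Bool} → (∀ x → p x ≡ q x) → count n p ≡ count n q
count-cong zero    p≗q = cong (if_then 1 else 0) (p≗q [])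
count-cong (suc n) p≗q = cong₂ _+_ (count-cong n (p≗q ∘ (false ∷_))) (count-cong n (p≗q ∘ (true ∷_)))

count-mono : ∀ n {p q : Vec Bool n → Bool} → (∀ x → p x ≡ true → q x ≡ true) → count n p ≤ count n q
count-mono zero {p} {q} p⇒q with p [] | q [] | p⇒q []
... | false | _     | _    = z≤n
... | true  | true  | _    = ℕ.≤-refl
... | true  | false | p⇒q₀ with () ← p⇒q₀ refl
count-mono (suc n) p⇒q =
  ℕ.+-mono-≤ (count-mono n (p⇒q ∘ (false ∷_))) (count-mono n (p⇒q ∘ (true ∷_)))

count-∨ : ∀ n (p q : Vec Bool n → Bool) → count n (λ x → p x ∨ q x) ≤ count n p + count n q
count-∨ zero p q with p [] | q []
... | true  | true  = s≤s z≤n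
... | true  | false = ℕ.≤-refl
... | false | _     = ℕ.≤-refl
count-∨ (suc n) p q = ℕ.≤-trans
  (ℕ.+-mono-≤ (count-∨ n (p ∘ (false ∷_)) (q ∘ (false ∷_))) (count-∨ n (p ∘ (true ∷_)) (q ∘ (true ∷_))))
  (ℕ.≤-reflexive (+-interchange (count n (p ∘ (false ∷_))) (count n (q ∘ (false ∷_)))
                                (count n (p ∘ (true ∷_))) (count n (q ∘ (true ∷_)))))

count-const-true : ∀ n → count n (λ _ → true) ≡ 2 ^ n
count-const-true zero    = refl
count-const-true (suc n) =
  trans (cong₂ _+_ (count-const-true n) (count-const-true n)) (cong (2 ^ n +_) (sym (ℕ.+-identityʳ (2 ^ n))))

count-translate : ∀ n (p : Vec Bool n → Bool) (v : Vec Bool n) → count n (λ u → p (u ⊕ v)) ≡ count n p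
count-translate zero    p []          = refl
count-translate (suc n) p (false ∷ v) =
  cong₂ _+_ (count-translate n (p ∘ (false ∷_)) v) (count-translate n (p ∘ (true ∷_)) v)
count-translate (suc n) p (true ∷ v)  =
  trans (cong₂ _+_ (count-translate n (p ∘ (true ∷_)) v) (count-translate n (p ∘ (false ∷_)) v))
        (ℕ.+-comm (count n (p ∘ (true ∷_))) (count n (p ∘ (false ∷_))))

count-witness : ∀ n (p : Vec Bool n → Bool) → 0 < count n p → ∃ λ x → p x ≡ true
count-witness zero p pos with p [] in eq
... | true = [] , eq
count-witness (suc n) p pos with count n (p ∘ (false ∷_)) in eq
... | suc _ = let x , px = count-witness n _ (subst (0 <_) (sym eq) (s≤s z≤n)) in false ∷ x , px
... | zero  = let x , px = count-witness n _ pos in true ∷ x , px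

count-<⇒∃ : ∀ n {p q : Vec Bool n → Bool} → count n q < count n p → ∃ λ x → p x ≡ true × q x ≡ false
count-<⇒∃ n {p} {q} q<p = let x , rx = count-witness n r r>0 in x , split (p x) (q x) rx
  where
  r : Vec Bool n → Bool
  r x = p x ∧ not (q x)
  covered : ∀ x → p x ≡ true → (q x ∨ r x) ≡ true
  covered x px with q x
  ... | true  = refl
  ... | false = trans (∧-identityʳ (p x)) px
  r>0 : 0 < count n r
  r>0 = ℕ.+-cancelˡ-< (count n q) 0 (count n r) (begin-strict
    count n q + 0       ≡⟨ ℕ.+-identityʳ (count n q) ⟩
    count n q           <⟨ q<p ⟩
    count n p           ≤⟨ count-mono n covered ⟩
    count n (λ x → q x ∨ r x) ≤⟨ count-∨ n q r ⟩
    count n q + count n r ∎)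
    where open ℕ.≤-Reasoning
  split : ∀ a b → a ∧ not b ≡ true → a ≡ true × b ≡ false
  split true false _ = refl , refl

pigeonhole : ∀ n k (h : Vec Bool n → Vec Bool k) (p : Vec Bool n → Bool) m →
             (∀ c → count n (λ u → p u ∧ does (h u ≟ᵥ c)) ≤ m) → count n p ≤ 2 ^ k * m
pigeonhole n zero h p m small = begin
  count n p
    ≡⟨ count-cong n (λ u → sym (trans (cong (p u ∧_) (fibre-[] (h u))) (∧-identityʳ (p u)))) ⟩
  count n (λ u → p u ∧ does (h u ≟ᵥ []))   ≤⟨ small [] ⟩
  m                                        ≡⟨ ℕ.*-identityˡ m ⟨
  1 * m                                    ∎
  where
  open ℕ.≤-Reasoning
  fibre-[] : (v : Vec Bool 0) → does (v ≟ᵥ []) ≡ true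
  fibre-[] [] = refl
pigeonhole n (suc k) h p m small = begin
  count n p                                     ≤⟨ count-mono n split-by-head ⟩
  count n (λ u → p-head false u ∨ p-head true u) ≤⟨ count-∨ n (p-head false) (p-head true) ⟩
  count n (p-head false) + count n (p-head true) ≤⟨ ℕ.+-mono-≤ (by-tail false) (by-tail true) ⟩
  2 ^ k * m + 2 ^ k * m                         ≡⟨ double (2 ^ k) m ⟩
  2 ^ suc k * m                                 ∎
  where
  open ℕ.≤-Reasoning
  p-head : Bool → Vec Bool n → Bool
  p-head b u = p u ∧ does (head (h u) Bool.≟ b)
  split-by-head : ∀ u → p u ≡ true → (p-head false u ∨ p-head true u) ≡ true
  split-by-head u pu rewrite pu with head (h u)
  ... | false = refl
  ... | true  = refl
  fibre-∷ : ∀ (v : Vec Bool (suc k)) b c → does (v ≟ᵥ (b ∷ c)) ≡ does (head v Bool.≟ b) ∧ does (tail v ≟ᵥ c)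
  fibre-∷ (_ ∷ _) b c = refl
  by-tail : ∀ b → count n (p-head b) ≤ 2 ^ k * m
  by-tail b = pigeonhole n k (tail ∘ h) (p-head b) m λ c → begin
    count n (λ u → p-head b u ∧ does (tail (h u) ≟ᵥ c))
      ≡⟨ count-cong n (λ u → trans (∧-assoc (p u) _ _) (cong (p u ∧_) (sym (fibre-∷ (h u) b c)))) ⟩
    count n (λ u → p u ∧ does (h u ≟ᵥ (b ∷ c))) ≤⟨ small (b ∷ c) ⟩
    m ∎
  double : ∀ a m → a * m + a * m ≡ (2 * a) * m
  double = solve-∀

pigeonhole-∃ : ∀ n k (h : Vec Bool n → Vec Bool k) m → 2 ^ k * m < 2 ^ n →
               ∃ λ c → m < count n (λ u → does (h u ≟ᵥ c))
pigeonhole-∃ n k h m few with ∃? k (λ c → m ℕ.<? count n (λ u → does (h u ≟ᵥ c)))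
... | yes large = large
... | no none   = ⊥-elim (ℕ.<-irrefl refl (ℕ.<-≤-trans few (begin
  2 ^ n                      ≡⟨ count-const-true n ⟨
  count n (λ _ → true)       ≤⟨ pigeonhole n k h (λ _ → true) m (λ c → ℕ.≮⇒≥ (none ∘ (c ,_))) ⟩
  2 ^ k * m                  ∎)))
  where open ℕ.≤-Reasoning

InjectiveOn : ∀ {n j k} → (Vec Bool k → Vec Bool j) → (Vec Bool n → Vec Bool k) → Set
InjectiveOn g h = ∀ x y → g (h x) ≡ g (h y) → h x ≡ h y

injectiveOn? : ∀ {n j k} (g : Vec Bool k → Vec Bool j) (h : Vec Bool n → Vec Bool k) →
               InjectiveOn g h ⊎ ∃₂ λ x y → g (h x) ≡ g (h y) × h x ≢ h y
injectiveOn? {n} g h with ∃? n (λ x → ∃? n (λ y → (g (h x) ≟ᵥ g (h y)) ×-dec ¬? (h x ≟ᵥ h y)))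
... | yes witness = inj₂ witness
... | no  none    = inj₁ λ x y same → decidable-stable (h x ≟ᵥ h y) (λ differ → none (x , y , same , differ))

-- Holds for every j, since one of two disjoint images has at most 2 ^ j points; only j ≤ 1 is needed.
Compressible : ℕ → Set
Compressible j = ∀ {n} (h₀ h₁ : Vec Bool n → Vec Bool (suc j)) → (∀ x y → h₀ x ≢ h₁ y) →
                 ∃ λ (g : Vec Bool (suc j) → Vec Bool j) → InjectiveOn g h₀ ⊎ InjectiveOn g h₁

≢-≢⇒≡ : ∀ {x y z : Bool} → x ≢ z → y ≢ z → x ≡ y
≢-≢⇒≡ x≢z y≢z = trans (¬-not x≢z) (sym (¬-not y≢z))

compressible-0 : Compressible 0
compressible-0 {n} h₀ h₁ disjoint =
  (λ _ → []) , inj₁ λ x y _ → same (h₀ x) (h₀ y) (h₁ (0ᵥ n)) (disjoint x (0ᵥ n)) (disjoint y (0ᵥ n))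
  where
  same : ∀ (a b c : Vec Bool 1) → a ≢ c → b ≢ c → a ≡ b
  same (a ∷ []) (b ∷ []) (c ∷ []) a≢c b≢c =
    cong (_∷ []) (≢-≢⇒≡ (a≢c ∘ cong (_∷ [])) (b≢c ∘ cong (_∷ [])))

first : Vec Bool 2 → Vec Bool 1
first v = head v ∷ []

pair : Bool → Bool → Vec Bool 2
pair a b = a ∷ b ∷ []

-- {a, b} and {c, d} are lines of the square in the two coordinate directions; together they
-- contain three of its four points, so the fourth is determined.
off-two-lines : ∀ (a b c d w : Vec Bool 2) → first a ≡ first b → a ≢ b → tail c ≡ tail d → c ≢ d →
                a ≢ w → b ≢ w → c ≢ w → d ≢ w → w ≡ pair (not (head a)) (not (head (tail c)))
off-two-lines (a₁ ∷ a₂ ∷ []) (.a₁ ∷ b₂ ∷ []) (c₁ ∷ c₂ ∷ []) (d₁ ∷ .c₂ ∷ []) (w₁ ∷ w₂ ∷ [])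
              refl a≢b refl c≢d a≢w b≢w c≢w d≢w = cong₂ pair (¬-not w₁≢a₁) (¬-not w₂≢c₂)
  where
  w₁≢a₁ : w₁ ≢ a₁
  w₁≢a₁ refl = a≢b (cong (pair a₁) (≢-≢⇒≡ (a≢w ∘ cong (pair a₁)) (b≢w ∘ cong (pair a₁))))
  w₂≢c₂ : w₂ ≢ c₂
  w₂≢c₂ refl = c≢d (cong (λ x → pair x c₂) (≢-≢⇒≡ (c≢w ∘ cong (λ x → pair x c₂))
                                                    (d≢w ∘ cong (λ x → pair x c₂))))

compressible-1 : Compressible 1
compressible-1 h₀ h₁ disjoint with injectiveOn? first h₀ | injectiveOn? tail h₀
... | inj₁ injective | _              = first , inj₁ injective
... | inj₂ _         | inj₁ injective = tail , inj₁ injective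
... | inj₂ (a , b , fa≡fb , a≢b) | inj₂ (c , d , tc≡td , c≢d) =
  first , inj₂ λ x y _ → trans (forced x) (sym (forced y))
  where
  forced : ∀ y → h₁ y ≡ pair (not (head (h₀ a))) (not (head (tail (h₀ c))))
  forced y = off-two-lines (h₀ a) (h₀ b) (h₀ c) (h₀ d) (h₁ y) fa≡fb a≢b tc≡td c≢d
                           (disjoint a y) (disjoint b y) (disjoint c y) (disjoint d y)

XorClosed : ∀ {n} → (Vec Bool n → Set) → Set
XorClosed S = ∀ a b → S a → S b → S (a ⊕ b)

CollisionsIn : ∀ {n k} → (Vec Bool n → Vec Bool k) → (Vec Bool n → Set) → Set
CollisionsIn h S = ∀ x y → h x ≡ h y → S (x ⊕ y)

Orthogonal : ∀ {n k} → Vec (Vec Bool n) k → Vec Bool n → Set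
Orthogonal ss z = All (λ s → ⟨ s , z ⟩ ≡ false) ss

collisionsIn-restrict : ∀ {n k} {h : Vec Bool (suc n) → Vec Bool k} {S : Vec Bool (suc n) → Set} →
                        CollisionsIn h S → ∀ b → CollisionsIn (h ∘ (b ∷_)) (S ∘ (false ∷_))
collisionsIn-restrict {S = S} collisions b x y e =
  subst (λ c → S (c ∷ (x ⊕ y))) (xor-same b) (collisions (b ∷ x) (b ∷ y) e)

xorClosed-restrict : ∀ {n} {S : Vec Bool (suc n) → Set} → XorClosed S → XorClosed (S ∘ (false ∷_))
xorClosed-restrict closed a b = closed (false ∷ a) (false ∷ b)

orthogonal-map : ∀ {n m k} {ss : Vec (Vec Bool n) k} {g : Vec Bool n → Vec Bool m} {z : Vec Bool m}
                 {w : Vec Bool n} → (∀ s → ⟨ g s , z ⟩ ≡ ⟨ s , w ⟩) →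
                 Orthogonal (map g ss) z → Orthogonal ss w
orthogonal-map same z⊥ = All.map (λ {s} → trans (sym (same s))) (map⁻ z⊥)

orthogonal-lift : ∀ {n k} (S : Vec Bool (suc n) → Set) → XorClosed S → ∀ {a} → S (true ∷ a) →
                  (ss : Vec (Vec Bool n) k) → (∀ z → Orthogonal ss z → S (false ∷ z)) →
                  ∀ z → Orthogonal (map (λ s → ⟨ s , a ⟩ ∷ s) ss) z → S z
orthogonal-lift S closed {a} Sa ss kernel (false ∷ z) z⊥ =
  kernel z (orthogonal-map (λ s → cong (_xor ⟨ s , z ⟩) (∧-zeroʳ ⟨ s , a ⟩)) z⊥)
orthogonal-lift S closed {a} Sa ss kernel (true ∷ z) z⊥ =
  subst (λ v → S (true ∷ v)) (⊕-cancelˡ a z)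
        (closed (true ∷ a) (false ∷ (a ⊕ z)) Sa (kernel (a ⊕ z) a⊕z⊥))
  where
  a⊕z⊥ : Orthogonal ss (a ⊕ z)
  a⊕z⊥ = orthogonal-map
    (λ s → trans (cong (_xor ⟨ s , z ⟩) (∧-identityʳ ⟨ s , a ⟩)) (sym (⟨⟩-linearʳ s a z))) z⊥

orthogonal-first-bit : ∀ {n k} (S : Vec Bool (suc n) → Set) (ss : Vec (Vec Bool n) k) →
                       (∀ z → Orthogonal ss z → S (false ∷ z)) →
                       ∀ z → Orthogonal ((true ∷ 0ᵥ n) ∷ map (false ∷_) ss) z → S z
orthogonal-first-bit S ss kernel (false ∷ z) (_ ∷ z⊥)   = kernel z (orthogonal-map (λ _ → refl) z⊥)
orthogonal-first-bit S ss kernel (true ∷ z)  (z₁⊥ ∷ _) with () ← trans (cong not (sym (⟨⟩-zeroˡ z))) z₁⊥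

-- Induction on n, splitting {0,1}^(suc n) by its first bit: a collision between the halves is a
-- vector of S with first bit 1, through which the kernel found on the 0-half is lifted; otherwise
-- the halves' images are disjoint, and compressing one of them saves a bit.
collisionsIn⇒kernel⊆ : ∀ n k → (∀ {j} → j < k → Compressible j) →
                       (S : Vec Bool n → Set) → XorClosed S →
                       (h : Vec Bool n → Vec Bool k) → CollisionsIn h S →
                       ∃ λ (ss : Vec (Vec Bool n) k) → ∀ z → Orthogonal ss z → S z
collisionsIn⇒kernel⊆ zero k _ S _ h collisions = replicate k [] , λ { [] _ → collisions [] [] refl }
collisionsIn⇒kernel⊆ (suc n) k compress S closed h collisions
  with ∃? n (λ x → ∃? n (λ y → h (false ∷ x) ≟ᵥ h (true ∷ y)))
... | yes (x , y , e) =
  let ss , kernel = collisionsIn⇒kernel⊆ n k compress (S ∘ (false ∷_)) (xorClosed-restrict closed)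
                                         (h ∘ (false ∷_)) (collisionsIn-restrict {S = S} collisions false)
  in map (λ s → ⟨ s , x ⊕ y ⟩ ∷ s) ss , orthogonal-lift S closed (collisions _ _ e) ss kernel
collisionsIn⇒kernel⊆ (suc n) zero compress S closed h collisions | no disjoint =
  ⊥-elim (disjoint (0ᵥ n , 0ᵥ n , vec₀ _ _))
  where
  vec₀ : (a b : Vec Bool 0) → a ≡ b
  vec₀ [] [] = refl
collisionsIn⇒kernel⊆ (suc n) (suc j) compress S closed h collisions | no disjoint =
  case compress (ℕ.n<1+n j) (h ∘ (false ∷_)) (h ∘ (true ∷_)) (λ x y e → disjoint (x , y , e)) of λ where
    (g , inj₁ injective) → drop-bit false g injective
    (g , inj₂ injective) → drop-bit true g injective
  where
  drop-bit : ∀ b (g : Vec Bool (suc j) → Vec Bool j) → InjectiveOn g (h ∘ (b ∷_)) →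
             ∃ λ (ss : Vec (Vec Bool (suc n)) (suc j)) → ∀ z → Orthogonal ss z → S z
  drop-bit b g injective =
    let ss , kernel = collisionsIn⇒kernel⊆ n j (compress ∘ ℕ.m<n⇒m<1+n)
                                           (S ∘ (false ∷_)) (xorClosed-restrict closed)
                                           (g ∘ h ∘ (b ∷_))
                                           (λ x y e → collisionsIn-restrict {S = S} collisions b x y (injective x y e))
    in (true ∷ 0ᵥ n) ∷ map (false ∷_) ss , orthogonal-first-bit S ss kernel

is-nothing≡false⇒just : ∀ {A : Set} (m : Maybe A) → is-nothing m ≡ false → ∃ λ b → m ≡ just b
is-nothing≡false⇒just (just b) _ = b , refl

∨≡false : ∀ a b → a ∨ b ≡ false → a ≡ false × b ≡ false
∨≡false false false _ = refl , refl

equal-parities⇒orthogonal : ∀ {n k} (ss : Vec (Vec Bool n) k) (x y : Vec Bool n) →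
                            map ⟨_, x ⟩ ss ≡ map ⟨_, y ⟩ ss → Orthogonal ss (x ⊕ y)
equal-parities⇒orthogonal []       x y _    = []
equal-parities⇒orthogonal (s ∷ ss) x y same with Vecₚ.∷-injective same
... | sx≡sy , rest = s⊥ ∷ equal-parities⇒orthogonal ss x y rest
  where
  s⊥ : ⟨ s , x ⊕ y ⟩ ≡ false
  s⊥ = trans (⟨⟩-linearʳ s x y) (trans (cong (_xor ⟨ s , y ⟩) sx≡sy) (xor-same ⟨ s , y ⟩))

nadt⇒protocol : ∀ {n} (f : PartialFn n) t → NADTp f t → OneWayProtocol f t
nadt⇒protocol f t (ss , l , correct) =
  (λ x → map ⟨_, x ⟩ ss) , (λ r y → l (zipWith _xor_ r (map ⟨_, y ⟩ ss))) ,
  λ x y b e → trans (cong l (sym (parities-⊕ ss x y))) (correct (x ⊕ y) b e)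

module ProtocolToNADT {n k} (f : PartialFn n) (h : Vec Bool n → Vec Bool k) (φ : Vec Bool k → Vec Bool n → Bool)
  (correct : ∀ x y b → f (x ⊕ y) ≡ just b → φ (h x) y ≡ b)
  (compress : ∀ {j} → j < k → Compressible j)
  (sparse : 2 ^ k * (undefCount f + undefCount f) < 2 ^ n)
  where

  undefined : Vec Bool n → Bool
  undefined x = is-nothing (f x)

  U : ℕ
  U = undefCount f

  inClass : Vec Bool k → Vec Bool n → Bool
  inClass c u = does (h u ≟ᵥ c)

  large-class : ∃ λ c → U + U < count n (inClass c)
  large-class = pigeonhole-∃ n k h (U + U) sparse

  c : Vec Bool k
  c = proj₁ large-class

  φ-at-class : ∀ {u} → h u ≡ c → ∀ {v b} → f (u ⊕ v) ≡ just b → φ c v ≡ b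
  φ-at-class hu≡c {v} {b} e = subst (λ m → φ m v ≡ b) hu≡c (correct _ v b e)

  count-undefined-at-either : ∀ v w → count n (λ u → undefined (u ⊕ v) ∨ undefined (u ⊕ w)) ≤ U + U
  count-undefined-at-either v w =
    ℕ.≤-trans (count-∨ n _ _) (ℕ.≤-reflexive (cong₂ _+_ (shifted v) (shifted w)))
    where
    shifted : ∀ t → count n (λ u → undefined (u ⊕ t)) ≡ U
    shifted t = trans (count-translate n undefined t) (sym (count-allVecs n undefined))

  member-avoiding : ∀ v w → ∃ λ u → h u ≡ c × (∃ λ b → f (u ⊕ v) ≡ just b)
                                             × (∃ λ b → f (u ⊕ w) ≡ just b)
  member-avoiding v w with count-<⇒∃ n (ℕ.≤-<-trans (count-undefined-at-either v w) (proj₂ large-class))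
  ... | u , in-class , good with ∨≡false _ _ good
  ... | defined-v , defined-w =
    u , does-true (h u ≟ᵥ c) in-class ,
    is-nothing≡false⇒just (f (u ⊕ v)) defined-v , is-nothing≡false⇒just (f (u ⊕ w)) defined-w

  Period : Vec Bool n → Set
  Period d = ∀ v → φ c (v ⊕ d) ≡ φ c v

  period-closed : XorClosed Period
  period-closed a b pa pb v = begin
    φ c (v ⊕ (a ⊕ b)) ≡⟨ cong (φ c) (⊕-assoc v a b) ⟨
    φ c ((v ⊕ a) ⊕ b) ≡⟨ pb (v ⊕ a) ⟩
    φ c (v ⊕ a)       ≡⟨ pa v ⟩
    φ c v             ∎
    where open ≡-Reasoning

  collisions-are-periods : CollisionsIn h Period
  collisions-are-periods x x' hx≡hx' v with member-avoiding v (v ⊕ (x ⊕ x'))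
  ... | u , hu≡c , (b , fv) , (b' , fw) = begin
    φ c (v ⊕ (x ⊕ x')) ≡⟨ φ-at-class hu≡c fw ⟩
    b'                 ≡⟨ correct x y b' (trans (cong f x⊕y) fw) ⟨
    φ (h x) y          ≡⟨ cong (λ m → φ m y) hx≡hx' ⟩
    φ (h x') y         ≡⟨ correct x' y b (trans (cong f (⊕-cancelˡ x' (u ⊕ v))) fv) ⟩
    b                  ≡⟨ φ-at-class hu≡c fv ⟨
    φ c v              ∎
    where
    open ≡-Reasoning
    y : Vec Bool n
    y = x' ⊕ (u ⊕ v)
    x⊕y : x ⊕ y ≡ u ⊕ (v ⊕ (x ⊕ x'))
    x⊕y = begin
      x ⊕ (x' ⊕ (u ⊕ v))   ≡⟨ ⊕-assoc x x' (u ⊕ v) ⟨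
      (x ⊕ x') ⊕ (u ⊕ v)   ≡⟨ ⊕-comm (x ⊕ x') (u ⊕ v) ⟩
      (u ⊕ v) ⊕ (x ⊕ x')   ≡⟨ ⊕-assoc u v (x ⊕ x') ⟩
      u ⊕ (v ⊕ (x ⊕ x'))   ∎

  kernel : ∃ λ (ss : Vec (Vec Bool n) k) → ∀ z → Orthogonal ss z → Period z
  kernel = collisionsIn⇒kernel⊆ n k compress Period period-closed h collisions-are-periods

  ss : Vec (Vec Bool n) k
  ss = proj₁ kernel

  parities : Vec Bool n → Vec Bool k
  parities x = map ⟨_, x ⟩ ss

  representative : ∃ λ u → h u ≡ c
  representative =
    let u , in-class = count-witness n (inClass c) (ℕ.≤-<-trans z≤n (proj₂ large-class))
    in u , does-true (h u ≟ᵥ c) in-class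

  u₀ : Vec Bool n
  u₀ = proj₁ representative

  decode : ∀ p → Dec (∃ λ x → parities x ≡ p) → Bool
  decode p (yes (x , _)) = φ c (u₀ ⊕ x)
  decode p (no _)        = false

  l : Vec Bool k → Bool
  l p = decode p (∃? n (λ x → parities x ≟ᵥ p))

  decode-correct : ∀ x b → f x ≡ just b → (found : Dec (∃ λ x' → parities x' ≡ parities x)) →
                   decode (parities x) found ≡ b
  decode-correct x b fx (no none) = ⊥-elim (none (x , refl))
  decode-correct x b fx (yes (x' , same)) = begin
    φ c (u₀ ⊕ x')
      ≡⟨ proj₂ kernel (x' ⊕ x) (equal-parities⇒orthogonal ss x' x same) (u₀ ⊕ x') ⟨
    φ c ((u₀ ⊕ x') ⊕ (x' ⊕ x))
      ≡⟨ cong (φ c) (trans (⊕-assoc u₀ x' (x' ⊕ x)) (cong (u₀ ⊕_) (⊕-cancelˡ x' x))) ⟩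
    φ c (u₀ ⊕ x)
      ≡⟨ φ-at-class (proj₂ representative) (trans (cong f (⊕-cancelˡ u₀ x)) fx) ⟩
    b ∎
    where open ≡-Reasoning

  nadt : NADTp f k
  nadt = ss , l , λ x b fx → decode-correct x b fx (∃? n (λ x' → parities x' ≟ᵥ parities x))

m<2^[n∸3]⇒8m<2^n : ∀ n {m} → m < 2 ^ (n ∸ 3) → 2 ^ 2 * (m + m) < 2 ^ n
m<2^[n∸3]⇒8m<2^n zero                (s≤s z≤n) = s≤s z≤n
m<2^[n∸3]⇒8m<2^n (suc zero)          (s≤s z≤n) = s≤s z≤n
m<2^[n∸3]⇒8m<2^n (suc (suc zero))    (s≤s z≤n) = s≤s z≤n
m<2^[n∸3]⇒8m<2^n (suc (suc (suc k))) {m} m<2^k = begin-strict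
  2 ^ 2 * (m + m)           <⟨ ℕ.*-monoʳ-< (2 ^ 2) (ℕ.+-mono-< m<2^k m<2^k) ⟩
  2 ^ 2 * (2 ^ k + 2 ^ k)   ≡⟨ octuple (2 ^ k) ⟩
  2 ^ (3 + k)               ∎
  where
  open ℕ.≤-Reasoning
  octuple : ∀ a → 4 * (a + a) ≡ 2 * (2 * (2 * a))
  octuple = solve-∀

compressible-<2 : ∀ {j} → j < 2 → Compressible j
compressible-<2 {0} _                 = compressible-0
compressible-<2 {1} _                 = compressible-1
compressible-<2 {suc (suc _)} (s≤s (s≤s ()))

theorem33 : (n : ℕ) (f : PartialFn n) →
    undefCount f < 2 ^ (n ∸ 3) →
    DccOneWay≡ f 2 →
    NADT⊕≡ f 2
theorem33 n f sparse ((h , φ , correct) , minimal) =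
  ProtocolToNADT.nadt f h φ correct compressible-<2 (m<2^[n∸3]⇒8m<2^n n sparse) ,
  λ t nadt → minimal t (nadt⇒protocol f t nadt)
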